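{- Let $N\ge 2$ and let $A_1,A_2,\ldots$ be a quasifibonacci sequence of level $N$. For every $n\ge1$, each of the posets $P_n$, $U_n$, $D_n$ that is nonempty is a modular lattice.
   Context: For an integer $N\ge 2$, a sequence $A_1,A_2,\ldots$ of positive integers is a quasifibonacci sequence of level $N$ if $A_{k+N}=A_{k+N-1}+\cdots+A_k$ for all $k\ge 1$, and $A_k>A_{k-1}+\cdots+A_1$ for all $1\le k\le N$. Let $\{0,1\}^{\omega}$ be the set of sequences $(a_1,a_2,\ldots)$ with $a_i\in\{0,1\}$ and $a_i=0$ for all but finitely many $i$. For $n\ge0$, $S_n=\{a\in\{0,1\}^{\omega}:\sum_{i}a_iA_i=n\}$. For nonzero $a$, $l(a)$ is the largest $i$ with $a_i=1$. The digraph $G_n$ has vertex set $S_n$, with a directed edge $a\to b$ iff there is $j\ge1$ such that $a_{j+N}=1$, $a_j=\cdots=a_{j+N-1}=0$, $b_{j+N}=0$, $b_j=\cdots=b_{j+N-1}=1$, and $a_t=b_t$ for all $t\notin\{j,\ldots,j+N\}$. The poset $P_n$ is $S_n$ ordered by $a\ge b$ iff there is a directed path in $G_n$ from $a$ to $b$. For $A_k\le n<A_{k+1}$, $U_n$ (resp. $D_n$) is the subposet of $P_n$ (with the induced order) on $\{a\in S_n: l(a)=k\}$ (resp. $\{a\in S_n:l(a)=k-1\}$); for $n<A_1$ these are empty. -}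

module Defs where

open import Data.Nat using (ℕ; zero; suc; _+_; _≤_; _<_)
open import Data.Bool using (Bool; true; false; if_then_else_)
open import Data.Product using (Σ; _×_; _,_; proj₁; ∃)
open import Data.Sum using (_⊎_)
open import Level using (Level; _⊔_)
open import Relation.Binary.Core using (Rel)
open import Relation.Binary.PropositionalEquality using (_≡_)
open import Relation.Binary.Lattice.Structures using (IsLattice)
open import Algebra.Core using (Op₂)

-- CONVENTION: everything is 0-indexed.  The Agda value  A i  is the paper's
-- A_{i+1}, and for a binary sequence  a : ℕ → Bool,  a i  is the paper's a_{i+1}.

Σ< : ℕ → (ℕ → ℕ) → ℕ
Σ< zero    f = 0
Σ< (suc m) f = Σ< m f + f m

QuasiFib : ℕ → (ℕ → ℕ) → Set
QuasiFib N A =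
  (∀ k → 0 < A k) ×
  (∀ k → A (k + N) ≡ Σ< N (λ t → A (k + t))) ×
  (∀ k → k < N → Σ< k A < A k)

-- binary sequences; finite support is part of membership in S_n
BSeq : Set
BSeq = ℕ → Bool

_≈ₛ_ : BSeq → BSeq → Set
a ≈ₛ b = ∀ i → a i ≡ b i

InS : (ℕ → ℕ) → ℕ → BSeq → Set
InS A n a = Σ ℕ λ M → (∀ i → M ≤ i → a i ≡ false) ×
                      (Σ< M (λ i → if a i then A i else 0) ≡ n)

Last : BSeq → ℕ → Set
Last a k = (a k ≡ true) × (∀ i → k < i → a i ≡ false)

Move : ℕ → BSeq → BSeq → Set
Move N a b = Σ ℕ λ j →
  (a (j + N) ≡ true) × (∀ t → t < N → a (j + t) ≡ false) ×
  (b (j + N) ≡ false) × (∀ t → t < N → b (j + t) ≡ true) ×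
  (∀ t → (t < j ⊎ j + N < t) → a t ≡ b t)

GEdge : ℕ → (ℕ → ℕ) → ℕ → BSeq → BSeq → Set
GEdge N A n a b = InS A n a × InS A n b × Move N a b

-- directed paths in G_n (vertices are sequences, i.e. up to pointwise equality)
data Path (N : ℕ) (A : ℕ → ℕ) (n : ℕ) : BSeq → BSeq → Set where
  done : ∀ {a b} → a ≈ₛ b → Path N A n a b
  step : ∀ {a c b} → GEdge N A n a c → Path N A n c b → Path N A n a b

Elt : (BSeq → Set) → Set
Elt X = Σ BSeq X

_≈ᴱ_ : {X : BSeq → Set} → Rel (Elt X) _
x ≈ᴱ y = proj₁ x ≈ₛ proj₁ y

Le : ℕ → (ℕ → ℕ) → ℕ → (X : BSeq → Set) → Rel (Elt X) _
Le N A n X x y = Path N A n (proj₁ y) (proj₁ x)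

IsModularLattice : ∀ {c ℓ₁ ℓ₂} {C : Set c} → Rel C ℓ₁ → Rel C ℓ₂ → Set (c ⊔ ℓ₁ ⊔ ℓ₂)
IsModularLattice {C = C} _≈_ _≤_ =
  Σ (Op₂ C) λ _∨_ → Σ (Op₂ C) λ _∧_ →
    IsLattice _≈_ _≤_ _∨_ _∧_ ×
    (∀ x y z → x ≤ z → ((x ∨ y) ∧ z) ≈ (x ∨ (y ∧ z)))

SetP : (ℕ → ℕ) → ℕ → BSeq → Set
SetP A n a = InS A n a

-- U_n and D_n, for the k with A k ≤ n < A (suc k)  (0-indexed; see convention)
SetU : (ℕ → ℕ) → ℕ → ℕ → BSeq → Set
SetU A n k a = InS A n a × Last a k

SetD : (ℕ → ℕ) → ℕ → ℕ → BSeq → Set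
SetD A n k a = InS A n a × Σ ℕ λ j → (suc j ≡ k) × Last a j

ModularIfNonempty : ℕ → (ℕ → ℕ) → ℕ → (BSeq → Set) → Set
ModularIfNonempty N A n X = Elt X → IsModularLattice (_≈ᴱ_ {X}) (Le N A n X)

module Submission where

-- A 0/1 sequence a is encoded by its prefix sums  π_a(p) = Σ_{i<p} a_i A_i.
-- (1) The order of P_n is the reversed pointwise order of prefix sums:
--     a ≥ b iff π_a ≤ π_b.  An elementary move trades A_{j+N} for
--     A_j + … + A_{j+N-1}, so it never decreases a prefix sum.  Conversely,
--     if π_a ≤ π_b and a ≠ b, then at the highest position where a and b
--     differ a has a firable block whose firing keeps π_a ≤ π_b; iterating
--     (an energy strictly decreases) yields a path a → b.
-- (2) Non-crossing: for a, b ∈ S_n with a_p = 1, b_p = 0 it never happens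
--     that π_a(p) < π_b(p) < π_a(p) + A_p.  This rests on the gap lemma: two
--     different subset sums of {A_i : i > p} differ by at least A_p.
-- (3) By (2), min(π_a, π_b) and max(π_a, π_b) grow by 0 or A_p at each step,
--     so they are the prefix sums of elements of S_n; by (1) these are the
--     join and meet.  Lattice operations are pointwise min/max in ℕ, whence
--     the modular law.  Min/max also preserve the last 1, so U_n and D_n are
--     closed under them, and the same argument applies to them.

open import Defs
open import Data.Nat using (ℕ; zero; suc; _+_; _∸_; _≤_; _<_; z≤n; s≤s; _⊓_; _⊔_)
open import Data.Nat.Properties
open import Data.Nat.Induction using (<-rec)
open import Data.Bool using (true; false; if_then_else_)
open import Data.Bool.Properties using () renaming (_≟_ to _≟ᵇ_)
open import Data.Product using (Σ; _×_; _,_; proj₁; proj₂)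
open import Data.Sum using (_⊎_; inj₁; inj₂)
open import Data.Empty using (⊥-elim)
open import Relation.Nullary using (¬_; yes; no)
open import Relation.Binary.PropositionalEquality
open import Relation.Binary.Lattice.Structures using (IsLattice)
open import Relation.Binary.Structures using (IsPartialOrder)

Σ<-cong : ∀ m {f g : ℕ → ℕ} → (∀ i → i < m → f i ≡ g i) → Σ< m f ≡ Σ< m g
Σ<-cong zero    h = refl
Σ<-cong (suc m) h = cong₂ _+_ (Σ<-cong m (λ i i<m → h i (m<n⇒m<1+n i<m))) (h m (n<1+n m))

Σ<-mono : ∀ m {f g : ℕ → ℕ} → (∀ i → i < m → f i ≤ g i) → Σ< m f ≤ Σ< m g
Σ<-mono zero    h = z≤n
Σ<-mono (suc m) h = +-mono-≤ (Σ<-mono m (λ i i<m → h i (m<n⇒m<1+n i<m))) (h m (n<1+n m))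

Σ<-mono-< : ∀ m {f g : ℕ → ℕ} s → (∀ i → i < m → f i ≤ g i) → s < m → f s < g s → Σ< m f < Σ< m g
Σ<-mono-< (suc m) s h s<m lt with s ≟ m
... | yes refl = +-mono-≤-< (Σ<-mono m (λ i i<m → h i (m<n⇒m<1+n i<m))) lt
... | no s≢m   = +-mono-<-≤ (Σ<-mono-< m s (λ i i<m → h i (m<n⇒m<1+n i<m)) (≤∧≢⇒< (≤-pred s<m) s≢m) lt)
                            (h m (n<1+n m))

Σ<-zeros : ∀ m {f : ℕ → ℕ} → (∀ i → i < m → f i ≡ 0) → Σ< m f ≡ 0
Σ<-zeros zero    h = refl
Σ<-zeros (suc m) h = cong₂ _+_ (Σ<-zeros m (λ i i<m → h i (m<n⇒m<1+n i<m))) (h m (n<1+n m))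

window : (ℕ → ℕ) → ℕ → ℕ → ℕ
window f p k = Σ< k (λ i → f (p + i))

Σ<-split : ∀ p k (f : ℕ → ℕ) → Σ< (p + k) f ≡ Σ< p f + window f p k
Σ<-split p zero    f rewrite +-identityʳ p = sym (+-identityʳ _)
Σ<-split p (suc k) f rewrite +-suc p k | Σ<-split p k f = +-assoc (Σ< p f) (window f p k) (f (p + k))

window-split : ∀ (f : ℕ → ℕ) p k l → window f p (k + l) ≡ window f p k + window f (p + k) l
window-split f p k zero rewrite +-identityʳ k = sym (+-identityʳ _)
window-split f p k (suc l) rewrite +-suc k l | window-split f p k l | +-assoc p k l =
  +-assoc (window f p k) (window f (p + k) l) (f (p + (k + l)))

window-head : ∀ (f : ℕ → ℕ) p k → window f p (suc k) ≡ f p + window f (suc p) k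
window-head f p k = trans (window-split f p 1 k)
  (cong₂ _+_ (cong f (+-identityʳ p)) (Σ<-cong k (λ i _ → cong f (trans (+-assoc p 1 i) (+-suc p i)))))

window-mono : ∀ {f g : ℕ → ℕ} p k → (∀ i → f i ≤ g i) → window f p k ≤ window g p k
window-mono p k h = Σ<-mono k (λ i _ → h (p + i))

term≤window : ∀ (f : ℕ → ℕ) p k i → i < k → f (p + i) ≤ window f p k
term≤window f p (suc k) i i<k with i ≟ k
... | yes refl = m≤n+m _ _
... | no i≢k   = ≤-trans (term≤window f p k i (≤∧≢⇒< (≤-pred i<k) i≢k)) (m≤m+n _ _)

⊓-step : ∀ a b c → ¬ (a < b × b < a + c) → ((a + c) ⊓ b ≡ a ⊓ b) ⊎ ((a + c) ⊓ b ≡ a ⊓ b + c)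
⊓-step a b c notBetween with b ≤? a
... | yes b≤a = inj₁ (trans (m≥n⇒m⊓n≡n (≤-trans b≤a (m≤m+n a c))) (sym (m≥n⇒m⊓n≡n b≤a)))
... | no b≰a with a + c ≤? b
...   | yes a+c≤b = inj₂ (trans (m≤n⇒m⊓n≡m a+c≤b) (cong (_+ c) (sym (m≤n⇒m⊓n≡m (<⇒≤ (≰⇒> b≰a))))))
...   | no a+c≰b  = ⊥-elim (notBetween (≰⇒> b≰a , ≰⇒> a+c≰b))

⊔-step : ∀ a b c → ¬ (a < b × b < a + c) → ((a + c) ⊔ b ≡ a ⊔ b) ⊎ ((a + c) ⊔ b ≡ a ⊔ b + c)
⊔-step a b c notBetween with b ≤? a
... | yes b≤a = inj₂ (trans (m≥n⇒m⊔n≡m (≤-trans b≤a (m≤m+n a c))) (cong (_+ c) (sym (m≥n⇒m⊔n≡m b≤a))))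
... | no b≰a with a + c ≤? b
...   | yes a+c≤b = inj₁ (trans (m≤n⇒m⊔n≡n a+c≤b) (sym (m≤n⇒m⊔n≡n (<⇒≤ (≰⇒> b≰a)))))
...   | no a+c≰b  = ⊥-elim (notBetween (≰⇒> b≰a , ≰⇒> a+c≰b))

⊓-⊔-modular : ∀ a b c → c ≤ a → (a ⊓ b) ⊔ c ≡ a ⊓ (b ⊔ c)
⊓-⊔-modular a b c c≤a = trans (⊔-distribʳ-⊓ c a b) (cong (_⊓ (b ⊔ c)) (m≥n⇒m⊔n≡m c≤a))

lastDifference : (x y : BSeq) → ∀ len →
  (∀ t → t < len → x t ≡ y t) ⊎
  (Σ ℕ λ i → i < len × ¬ (x i ≡ y i) × (∀ t → i < t → t < len → x t ≡ y t))
lastDifference x y zero = inj₁ (λ t ())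
lastDifference x y (suc l) with x l ≟ᵇ y l
... | no xl≢yl = inj₂ (l , n<1+n l , xl≢yl , λ t l<t t<1+l → ⊥-elim (<-irrefl refl (<-≤-trans l<t (≤-pred t<1+l))))
... | yes xl≡yl with lastDifference x y l
...   | inj₁ agree = inj₁ (λ t t<1+l → below t t<1+l)
  where below : ∀ t → t < suc l → x t ≡ y t
        below t t<1+l with t ≟ l
        ... | yes refl = xl≡yl
        ... | no t≢l   = agree t (≤∧≢⇒< (≤-pred t<1+l) t≢l)
...   | inj₂ (i , i<l , differ , agree) = inj₂ (i , m<n⇒m<1+n i<l , differ , above)
  where above : ∀ t → i < t → t < suc l → x t ≡ y t
        above t i<t t<1+l with t ≟ l
        ... | yes refl = xl≡yl
        ... | no t≢l   = agree t i<t (≤∧≢⇒< (≤-pred t<1+l) t≢l)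

findOne : (z : BSeq) → ∀ w len → (Σ ℕ λ t → t < len × z (w + t) ≡ true) ⊎ (∀ t → t < len → z (w + t) ≡ false)
findOne z w zero = inj₂ (λ t ())
findOne z w (suc l) with z (w + l) in zl
... | true = inj₁ (l , n<1+n l , zl)
... | false with findOne z w l
...   | inj₁ (t , t<l , zt) = inj₁ (t , m<n⇒m<1+n t<l , zt)
...   | inj₂ zeros = inj₂ below
  where below : ∀ t → t < suc l → z (w + t) ≡ false
        below t t<1+l with t ≟ l
        ... | yes refl = zl
        ... | no t≢l   = zeros t (≤∧≢⇒< (≤-pred t<1+l) t≢l)

module QuasiFibonacci (N : ℕ) (A : ℕ → ℕ) (qf : QuasiFib N A) where

  positive : ∀ k → 0 < A k
  positive = proj₁ qf

  recurrence : ∀ k → A (k + N) ≡ window A k N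
  recurrence = proj₁ (proj₂ qf)

  initial : ∀ k → k < N → Σ< k A < A k
  initial = proj₂ (proj₂ qf)

  -- The sum of any g ≤ N consecutive terms is at most the next term.  For
  -- small indices this is the initial condition, otherwise the window is
  -- part of the recurrence for A (m + g).
  windowBound : ∀ m g → g ≤ N → window A m g ≤ A (m + g)
  windowBound m g g≤N with m + g <? N
  ... | yes m+g<N = ≤-trans (m≤n+m _ _) (subst (_≤ A (m + g)) (Σ<-split m g A) (<⇒≤ (initial (m + g) m+g<N)))
  ... | no m+g≮N = begin
      window A m g                  ≤⟨ m≤n+m _ _ ⟩
      window A k h + window A m g   ≡⟨ cong (λ v → window A k h + window A v g) (sym k+h≡m) ⟩
      window A k h + window A (k + h) g ≡⟨ sym (window-split A k h g) ⟩
      window A k (h + g)            ≡⟨ cong (window A k) (sym N≡h+g) ⟩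
      window A k N                  ≡⟨ sym (recurrence k) ⟩
      A (k + N)                     ≡⟨ cong A k+N≡m+g ⟩
      A (m + g)                     ∎
    where
      open ≤-Reasoning
      k = (m + g) ∸ N
      k+N≡m+g : k + N ≡ m + g
      k+N≡m+g = m∸n+n≡m (≮⇒≥ m+g≮N)
      k≤m : k ≤ m
      k≤m = subst (k ≤_) (m+n∸n≡m m N) (∸-monoˡ-≤ N (+-monoʳ-≤ m g≤N))
      h = m ∸ k
      k+h≡m : k + h ≡ m
      k+h≡m = m+[n∸m]≡n k≤m
      N≡h+g : N ≡ h + g
      N≡h+g = +-cancelˡ-≡ k _ _ (trans k+N≡m+g (trans (cong (_+ g) (sym k+h≡m)) (+-assoc k h g)))

  contribution : BSeq → ℕ → ℕ
  contribution a i = if a i then A i else 0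

  prefix : BSeq → ℕ → ℕ
  prefix a p = Σ< p (contribution a)

  _≼_ : BSeq → BSeq → Set
  a ≼ b = ∀ p → prefix a p ≤ prefix b p

  contribution≤A : ∀ a i → contribution a i ≤ A i
  contribution≤A a i with a i
  ... | true  = ≤-refl
  ... | false = z≤n

  contribution-one : ∀ a i → a i ≡ true → contribution a i ≡ A i
  contribution-one a i ai rewrite ai = refl

  contribution-zero : ∀ a i → a i ≡ false → contribution a i ≡ 0
  contribution-zero a i ai rewrite ai = refl

  contribution-cong : ∀ a b i → a i ≡ b i → contribution a i ≡ contribution b i
  contribution-cong a b i ai≡bi = cong (λ v → if v then A i else 0) ai≡bi

  prefix-split : ∀ a p k → prefix a (p + k) ≡ prefix a p + window (contribution a) p k
  prefix-split a p k = Σ<-split p k (contribution a)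

  prefix-mono : ∀ a {p q} → p ≤ q → prefix a p ≤ prefix a q
  prefix-mono a {p} {q} p≤q = subst (λ v → prefix a p ≤ prefix a v) (m+[n∸m]≡n p≤q)
    (subst (prefix a p ≤_) (sym (prefix-split a p (q ∸ p))) (m≤m+n _ _))

  prefix-cong : ∀ a b → a ≈ₛ b → ∀ p → prefix a p ≡ prefix b p
  prefix-cong a b a≈b p = Σ<-cong p (λ i _ → contribution-cong a b i (a≈b i))

  prefix-agree-extend : ∀ x y q e → (∀ i → i < e → x (q + i) ≡ y (q + i)) →
                        prefix x q ≡ prefix y q → prefix x (q + e) ≡ prefix y (q + e)
  prefix-agree-extend x y q e agree eq rewrite prefix-split x q e | prefix-split y q e =
    cong₂ _+_ eq (Σ<-cong e (λ i i<e → contribution-cong x y (q + i) (agree i i<e)))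

  prefix-agree-retract : ∀ x y q e → (∀ i → i < e → x (q + i) ≡ y (q + i)) →
                         prefix x (q + e) ≡ prefix y (q + e) → prefix x q ≡ prefix y q
  prefix-agree-retract x y q e agree eq
    rewrite prefix-split x q e | prefix-split y q e
          | Σ<-cong e (λ i i<e → contribution-cong x y (q + i) (agree i i<e)) = +-cancelʳ-≡ _ _ _ eq

  prefix-stable : ∀ a M → (∀ i → M ≤ i → a i ≡ false) → ∀ K → M ≤ K → prefix a K ≡ prefix a M
  prefix-stable a M zeros K M≤K = subst (λ v → prefix a v ≡ prefix a M) (m+[n∸m]≡n M≤K)
    (trans (prefix-split a M (K ∸ M))
      (trans (cong (prefix a M +_) (Σ<-zeros (K ∸ M) (λ i _ → contribution-zero a (M + i) (zeros (M + i) (m≤m+n M i)))))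
             (+-identityʳ _)))

  -- A sequence is determined by its prefix sums, as every A_i is positive.
  prefix-injective : ∀ a b → (∀ p → prefix a p ≡ prefix b p) → a ≈ₛ b
  prefix-injective a b same i = sameBit (+-cancelˡ-≡ (prefix a i) _ _
      (trans (same (suc i)) (cong (_+ contribution b i) (sym (same i)))))
    where
      sameBit : contribution a i ≡ contribution b i → a i ≡ b i
      sameBit e with a i | b i | positive i
      ... | true  | true  | _   = refl
      ... | false | false | _   = refl
      ... | true  | false | A>0 = ⊥-elim (<-irrefl (sym e) A>0)
      ... | false | true  | A>0 = ⊥-elim (<-irrefl e A>0)

  Firable : BSeq → ℕ → Set
  Firable a j = (a (j + N) ≡ true) × (∀ t → t < N → a (j + t) ≡ false)

  windowCases : ∀ j p → p ≤ j ⊎ ((Σ ℕ λ d → d ≤ N × p ≡ j + d) ⊎ j + N < p)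
  windowCases j p with p ≤? j
  ... | yes p≤j = inj₁ p≤j
  ... | no p≰j with p ≤? j + N
  ...   | yes p≤j+N = inj₂ (inj₁ (p ∸ j , subst (p ∸ j ≤_) (m+n∸m≡n j N) (∸-monoˡ-≤ j p≤j+N) ,
                                   sym (m+[n∸m]≡n (<⇒≤ (≰⇒> p≰j)))))
  ...   | no p≰j+N  = inj₂ (inj₂ (≰⇒> p≰j+N))

  module MoveFacts (a b : BSeq) (j : ℕ) (firable : Firable a j)
                   (b-top : b (j + N) ≡ false) (b-ones : ∀ t → t < N → b (j + t) ≡ true)
                   (outside : ∀ t → (t < j ⊎ j + N < t) → a t ≡ b t) where

    below : ∀ p → p ≤ j → prefix a p ≡ prefix b p
    below p p≤j = Σ<-cong p (λ i i<p → contribution-cong a b i (outside i (inj₁ (<-≤-trans i<p p≤j))))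

    inside-a : ∀ d → d ≤ N → prefix a (j + d) ≡ prefix a j
    inside-a d d≤N = trans (prefix-split a j d)
      (trans (cong (prefix a j +_) (Σ<-zeros d (λ i i<d → contribution-zero a (j + i) (proj₂ firable i (<-≤-trans i<d d≤N)))))
             (+-identityʳ _))

    inside-b : ∀ d → d ≤ N → prefix b (j + d) ≡ prefix a j + window A j d
    inside-b d d≤N = trans (prefix-split b j d)
      (cong₂ _+_ (sym (below j ≤-refl)) (Σ<-cong d (λ i i<d → contribution-one b (j + i) (b-ones i (<-≤-trans i<d d≤N)))))

    -- The recurrence A_{j+N} = A_j + … + A_{j+N-1} balances the books at j + N + 1.
    past-window : prefix a (suc (j + N)) ≡ prefix b (suc (j + N))
    past-window = begin
        prefix a (j + N) + contribution a (j + N)  ≡⟨ cong₂ _+_ (inside-a N ≤-refl) (contribution-one a (j + N) (proj₁ firable)) ⟩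
        prefix a j + A (j + N)                     ≡⟨ cong (prefix a j +_) (recurrence j) ⟩
        prefix a j + window A j N                  ≡⟨ sym (+-identityʳ _) ⟩
        prefix a j + window A j N + 0              ≡⟨ cong₂ _+_ (sym (inside-b N ≤-refl)) (sym (contribution-zero b (j + N) b-top)) ⟩
        prefix b (j + N) + contribution b (j + N)  ∎
      where open ≡-Reasoning

    above : ∀ p → j + N < p → prefix a p ≡ prefix b p
    above p lt = subst (λ v → prefix a v ≡ prefix b v) (m+[n∸m]≡n lt)
      (prefix-agree-extend a b (suc (j + N)) (p ∸ suc (j + N)) (λ i _ → outside _ (inj₂ (m≤m+n _ _))) past-window)

    dominated : a ≼ b
    dominated p with windowCases j p
    ... | inj₁ p≤j                     = ≤-reflexive (below p p≤j)
    ... | inj₂ (inj₁ (d , d≤N , refl)) = subst₂ _≤_ (sym (inside-a d d≤N)) (sym (inside-b d d≤N)) (m≤m+n _ _)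
    ... | inj₂ (inj₂ lt)               = ≤-reflexive (above p lt)

    strictly : prefix a (j + N) < prefix b (j + N)
    strictly = subst₂ _<_ (sym (inside-a N ≤-refl)) (sym (inside-b N ≤-refl))
      (subst (λ v → prefix a j < prefix a j + v) (recurrence j)
        (subst (_< prefix a j + A (j + N)) (+-identityʳ _) (+-monoʳ-< (prefix a j) (positive (j + N)))))

  move-dominated : ∀ {a b} → Move N a b → a ≼ b
  move-dominated {a} {b} (j , a-top , a-zeros , b-top , b-ones , outside) =
    MoveFacts.dominated a b j (a-top , a-zeros) b-top b-ones outside

  path-dominated : ∀ {n a b} → Path N A n a b → a ≼ b
  path-dominated {a = a} {b} (done a≈b) p = ≤-reflexive (prefix-cong a b a≈b p)
  path-dominated (step (_ , _ , mv) rest) p = ≤-trans (move-dominated mv p) (path-dominated rest p)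

  fire : ℕ → BSeq → BSeq
  fire j a i with i ≟ j + N
  ... | yes _ = false
  ... | no _ with j ≤? i
  ...   | no _ = a i
  ...   | yes _ with i <? j + N
  ...     | yes _ = true
  ...     | no _  = a i

  fire-top : ∀ j a → fire j a (j + N) ≡ false
  fire-top j a with (j + N) ≟ j + N
  ... | yes _ = refl
  ... | no ne = ⊥-elim (ne refl)

  fire-ones : ∀ j a t → t < N → fire j a (j + t) ≡ true
  fire-ones j a t t<N with (j + t) ≟ j + N
  ... | yes eq = ⊥-elim (<-irrefl (+-cancelˡ-≡ j _ _ eq) t<N)
  ... | no _ with j ≤? j + t
  ...   | no j≰ = ⊥-elim (j≰ (m≤m+n j t))
  ...   | yes _ with (j + t) <? j + N
  ...     | yes _   = refl
  ...     | no j+t≮ = ⊥-elim (j+t≮ (+-monoʳ-< j t<N))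

  fire-outside : ∀ j a t → (t < j ⊎ j + N < t) → a t ≡ fire j a t
  fire-outside j a t out with t ≟ j + N
  fire-outside j a t (inj₁ lt) | yes refl = ⊥-elim (m+n≮m j N lt)
  fire-outside j a t (inj₂ lt) | yes refl = ⊥-elim (<-irrefl refl lt)
  ... | no _ with j ≤? t
  ...   | no _ = refl
  ...   | yes j≤t with t <? j + N
  ...     | no _ = refl
  fire-outside j a t (inj₁ lt) | no _ | yes j≤t | yes _  = ⊥-elim (<-irrefl refl (<-≤-trans lt j≤t))
  fire-outside j a t (inj₂ lt) | no _ | yes j≤t | yes lt′ = ⊥-elim (<-irrefl refl (<-trans lt lt′))

  fire-move : ∀ j a → Firable a j → Move N a (fire j a)
  fire-move j a (a-top , a-zeros) = j , a-top , a-zeros , fire-top j a , fire-ones j a , fire-outside j a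

  module FireFacts (j : ℕ) (a : BSeq) (firable : Firable a j) =
    MoveFacts a (fire j a) j firable (fire-top j a) (fire-ones j a) (fire-outside j a)

  -- Energy below K: Σ_{p<K} (π(K) − π(p)).  Firing a block inside [0, K)
  -- keeps π(K) and raises π(j + N), so the energy drops.
  energy : ℕ → BSeq → ℕ
  energy K z = Σ< K (λ p → prefix z K ∸ prefix z p)

  fire-energy : ∀ j a → Firable a j → ∀ K → j + N < K → energy K (fire j a) < energy K a
  fire-energy j a firable K lt = subst (λ v → Σ< K (λ p → v ∸ prefix (fire j a) p) < energy K a) (above K lt)
      (Σ<-mono-< K (j + N) (λ p _ → ∸-monoʳ-≤ (prefix a K) (dominated p)) lt
        (∸-monoʳ-< strictly (subst (prefix (fire j a) (j + N) ≤_) (sym (above K lt)) (prefix-mono (fire j a) (<⇒≤ lt)))))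
    where open FireFacts j a firable

  fire-window : ∀ j a → Firable a j → ∀ q k → q ≤ j → j + N < q + k →
                window (contribution (fire j a)) q k ≡ window (contribution a) q k
  fire-window j a firable q k q≤j lt = sym (+-cancelˡ-≡ (prefix a q) _ _
      (trans (sym (prefix-split a q k)) (trans (above (q + k) lt)
        (trans (prefix-split (fire j a) q k) (cong (_+ window (contribution (fire j a)) q k) (sym (below q q≤j)))))))
    where open FireFacts j a firable

  -- Support z q r explains a 1 of z at r ≥ q from the left: either there is
  -- a firable block at some j ≥ q below r, or for some c ∈ [q, q + N) the
  -- 1's of z on [c, r] outweigh A_c + (A_c + … + A_{r-1}).  (The firable
  -- case also records the analogous weight bound, needed in the proof of
  -- completeness.)
  data Support (z : BSeq) (q r : ℕ) : Set where
    firableAt  : ∀ j d → q ≤ j → N ≤ d → r ≡ j + d → Firable z j →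
                 window A j d ≤ window (contribution z) j (suc d) → Support z q r
    groundedAt : ∀ c e → q ≤ c → c < q + N → r ≡ c + e →
                 A c + window A c e ≤ window (contribution z) c (suc e) → Support z q r

  -- A weight bound up to p + e survives a jump of g ≤ N to a further 1 of z,
  -- because the skipped terms sum to at most A_{p+e+g} (windowBound).
  weight-extend : ∀ z base p e g → 0 < g → g ≤ N → z (p + e + g) ≡ true →
                  base + window A p e ≤ window (contribution z) p (suc e) →
                  base + window A p (e + g) ≤ window (contribution z) p (suc (e + g))
  weight-extend z base p e (suc g) 0<g g≤N z-one bound = begin
      base + window A p (e + suc g)                      ≡⟨ cong (base +_) (window-split A p e (suc g)) ⟩
      base + (window A p e + window A (p + e) (suc g))   ≡⟨ sym (+-assoc base _ _) ⟩
      base + window A p e + window A (p + e) (suc g)     ≤⟨ +-mono-≤ bound (windowBound (p + e) (suc g) g≤N) ⟩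
      S + A (p + e + suc g)                              ≡⟨ cong (S +_) (sym (contribution-one z _ z-one)) ⟩
      S + contribution z (p + e + suc g)                 ≡⟨ cong (λ v → S + contribution z v) (sym index) ⟩
      S + contribution z (p + suc e + g)                 ≤⟨ +-monoʳ-≤ S (term≤window (contribution z) (p + suc e) (suc g) g (n<1+n g)) ⟩
      S + window (contribution z) (p + suc e) (suc g)    ≡⟨ sym (window-split (contribution z) p (suc e) (suc g)) ⟩
      window (contribution z) p (suc (e + suc g))        ∎
    where
      open ≤-Reasoning
      S = window (contribution z) p (suc e)
      index : p + suc e + g ≡ p + e + suc g
      index = trans (cong (_+ g) (+-suc p e)) (sym (+-suc (p + e) g))

  support-extend : ∀ z q r g → 0 < g → g ≤ N → z (r + g) ≡ true → Support z q r → Support z q (r + g)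
  support-extend z q _ g 0<g g≤N z-one (firableAt j d q≤j N≤d refl firable bound) =
    firableAt j (d + g) q≤j (≤-trans N≤d (m≤m+n d g)) (+-assoc j d g) firable (weight-extend z 0 j d g 0<g g≤N z-one bound)
  support-extend z q _ g 0<g g≤N z-one (groundedAt c e q≤c c<q+N refl bound) =
    groundedAt c (e + g) q≤c c<q+N (+-assoc c e g) (weight-extend z (A c) c e g 0<g g≤N z-one bound)

  -- Far from q, look at the N positions below r: either they are all 0 (a
  -- firable block ending at r), or they contain a 1 at distance ≤ N whose
  -- support extends to r.
  support-far : ∀ z q r → z r ≡ true → q + N ≤ r →
                (∀ {r′} → r′ < r → z r′ ≡ true → q ≤ r′ → Support z q r′) → Support z q r
  support-far z q r z-one q+N≤r support-below = fromSearch (findOne z j N)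
    where
      j = r ∸ N
      j+N≡r : j + N ≡ r
      j+N≡r = m∸n+n≡m (≤-trans (m≤n+m N q) q+N≤r)
      q≤j : q ≤ j
      q≤j = subst (_≤ j) (m+n∸n≡m q N) (∸-monoˡ-≤ N q+N≤r)
      fromSearch : (Σ ℕ λ t → t < N × z (j + t) ≡ true) ⊎ (∀ t → t < N → z (j + t) ≡ false) → Support z q r
      fromSearch (inj₂ zeros) = firableAt j N q≤j ≤-refl (sym j+N≡r) (top , zeros)
          (subst (_≤ window (contribution z) j (suc N)) (recurrence j)
            (subst (_≤ window (contribution z) j (suc N)) (contribution-one z (j + N) top) (m≤n+m _ _)))
        where top = subst (λ v → z v ≡ true) (sym j+N≡r) z-one
      fromSearch (inj₁ (t , t<N , zt)) = subst (Support z q) j+t+g≡r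
          (support-extend z q (j + t) g (m<n⇒0<n∸m t<N) (m∸n≤m N t) (subst (λ v → z v ≡ true) (sym j+t+g≡r) z-one)
            (support-below (subst (j + t <_) j+N≡r (+-monoʳ-< j t<N)) zt (≤-trans q≤j (m≤m+n j t))))
        where
          g = N ∸ t
          j+t+g≡r : j + t + g ≡ r
          j+t+g≡r = trans (+-assoc j t g) (trans (cong (j +_) (m+[n∸m]≡n (<⇒≤ t<N))) j+N≡r)

  -- Every 1 at r ≥ q has support: near q it is grounded at r itself.
  support : ∀ z q r → z r ≡ true → q ≤ r → Support z q r
  support z q = <-rec (λ r → z r ≡ true → q ≤ r → Support z q r) supportAt
    where
      supportAt : ∀ r → (∀ {r′} → r′ < r → z r′ ≡ true → q ≤ r′ → Support z q r′) → z r ≡ true → q ≤ r → Support z q r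
      supportAt r support-below z-one q≤r with q + N ≤? r
      ... | yes q+N≤r = support-far z q r z-one q+N≤r support-below
      ... | no q+N≰r  = groundedAt r 0 q≤r (≰⇒> q+N≰r) (sym (+-identityʳ r))
            (subst (λ v → A r + 0 ≤ 0 + contribution z v) (sym (+-identityʳ r))
              (≤-reflexive (trans (+-identityʳ _) (sym (contribution-one z r z-one)))))

  -- The gap lemma: window sums over [p + 1, p + 1 + k) that differ, differ by
  -- at least A_p.  Compare the windows at the highest position where the
  -- sequences differ: if the larger side has a firable block there, fire it
  -- (window sums are unchanged, energy drops) and repeat; otherwise that 1
  -- is grounded, and its weight already exceeds everything below plus A_p.

  zero-capped : ∀ w q i → w (q + i) ≡ false → window (contribution w) q (suc i) ≤ window A q i
  zero-capped w q i w-zero = begin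
      window (contribution w) q i + contribution w (q + i) ≡⟨ cong (window (contribution w) q i +_) (contribution-zero w _ w-zero) ⟩
      window (contribution w) q i + 0                      ≡⟨ +-identityʳ _ ⟩
      window (contribution w) q i                          ≤⟨ window-mono q i (contribution≤A w) ⟩
      window A q i                                         ∎
    where open ≤-Reasoning

  -- A 1 at q + i grounded at c ∈ [q, q + N), q = p + 1, outweighs
  -- A_p + A_q + … + A_{q+i-1}: the terms A_p, …, A_{c-1} are fewer than N + 1,
  -- so windowBound absorbs them into A_c.
  grounded-weight : ∀ z p i c e → suc p ≤ c → c < suc p + N → suc p + i ≡ c + e →
                    A c + window A c e ≤ window (contribution z) c (suc e) →
                    A p + window A (suc p) i ≤ window (contribution z) (suc p) (suc i)
  grounded-weight z p i c e q≤c c<q+N q+i≡c+e bound = begin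
      A p + window A q i                        ≡⟨ cong (λ v → A p + window A q v) i≡f+e ⟩
      A p + window A q (f + e)                  ≡⟨ cong (A p +_) (window-split A q f e) ⟩
      A p + (window A q f + window A (q + f) e) ≡⟨ sym (+-assoc (A p) _ _) ⟩
      A p + window A q f + window A (q + f) e   ≡⟨ cong (λ v → A p + window A q f + window A v e) q+f≡c ⟩
      A p + window A q f + window A c e         ≤⟨ +-monoˡ-≤ (window A c e) below-c ⟩
      A c + window A c e                        ≤⟨ bound ⟩
      window Z c (suc e)                        ≤⟨ m≤n+m _ (window Z q f) ⟩
      window Z q f + window Z c (suc e)         ≡⟨ cong (λ v → window Z q f + window Z v (suc e)) (sym q+f≡c) ⟩
      window Z q f + window Z (q + f) (suc e)   ≡⟨ sym (window-split Z q f (suc e)) ⟩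
      window Z q (f + suc e)                    ≡⟨ cong (window Z q) (trans (+-suc f e) (cong suc (sym i≡f+e))) ⟩
      window Z q (suc i)                        ∎
    where
      open ≤-Reasoning
      q = suc p
      Z = contribution z
      f = c ∸ q
      q+f≡c : q + f ≡ c
      q+f≡c = m+[n∸m]≡n q≤c
      i≡f+e : i ≡ f + e
      i≡f+e = +-cancelˡ-≡ q _ _ (trans q+i≡c+e (trans (cong (_+ e) (sym q+f≡c)) (+-assoc q f e)))
      below-c : A p + window A q f ≤ A c
      below-c = subst (_≤ A c) (window-head A p f)
        (subst (λ v → window A p (suc f) ≤ A v) (trans (+-suc p f) q+f≡c)
          (windowBound p (suc f) (+-cancelˡ-< q f N (subst (_< q + N) (sym q+f≡c) c<q+N))))

  module Gap (p k : ℕ) where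
    q = suc p
    K = q + k

    FirableInside : BSeq → Set
    FirableInside z = Σ ℕ λ j → q ≤ j × j + N < K × Firable z j

    grounded-gap : ∀ z w i c e → i < k → q ≤ c → c < q + N → q + i ≡ c + e →
                   A c + window A c e ≤ window (contribution z) c (suc e) → w (q + i) ≡ false →
                   (∀ t → i < t → t < k → z (q + t) ≡ w (q + t)) →
                   window (contribution w) q k + A p ≤ window (contribution z) q k
    grounded-gap z w i c e i<k q≤c c<q+N q+i≡c+e bound w-zero agree = begin
        window W q k + A p                           ≡⟨ cong (λ v → window W q v + A p) (sym i+1+l≡k) ⟩
        window W q (suc i + l) + A p                 ≡⟨ cong (_+ A p) (window-split W q (suc i) l) ⟩
        window W q (suc i) + tail W + A p            ≡⟨ +-assoc (window W q (suc i)) _ _ ⟩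
        window W q (suc i) + (tail W + A p)          ≡⟨ cong (window W q (suc i) +_) (+-comm _ (A p)) ⟩
        window W q (suc i) + (A p + tail W)          ≡⟨ sym (+-assoc (window W q (suc i)) _ _) ⟩
        window W q (suc i) + A p + tail W            ≤⟨ +-mono-≤ (+-monoˡ-≤ (A p) (zero-capped w q i w-zero)) (≤-reflexive tails) ⟩
        window A q i + A p + tail Z                  ≡⟨ cong (_+ tail Z) (+-comm (window A q i) (A p)) ⟩
        A p + window A q i + tail Z                  ≤⟨ +-monoˡ-≤ _ (grounded-weight z p i c e q≤c c<q+N q+i≡c+e bound) ⟩
        window Z q (suc i) + tail Z                  ≡⟨ sym (window-split Z q (suc i) l) ⟩
        window Z q (suc i + l)                       ≡⟨ cong (window Z q) i+1+l≡k ⟩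
        window Z q k                                 ∎
      where
        open ≤-Reasoning
        W = contribution w
        Z = contribution z
        l = k ∸ suc i
        i+1+l≡k : suc i + l ≡ k
        i+1+l≡k = m+[n∸m]≡n i<k
        tail : (ℕ → ℕ) → ℕ
        tail f = window f (q + suc i) l
        tails : tail W ≡ tail Z
        tails = Σ<-cong l (λ u u<l → contribution-cong w z _ (sym (trans (cong z (+-assoc q (suc i) u))
                  (trans (agree (suc i + u) (s≤s (m≤m+n i u)) (subst (suc i + u <_) i+1+l≡k (+-monoʳ-< (suc i) u<l)))
                    (cong w (sym (+-assoc q (suc i) u)))))))

    top-difference : ∀ z w i → i < k → z (q + i) ≡ true → w (q + i) ≡ false →
                     (∀ t → i < t → t < k → z (q + t) ≡ w (q + t)) →
                     FirableInside z ⊎ (window (contribution w) q k + A p ≤ window (contribution z) q k)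
    top-difference z w i i<k z-one w-zero agree with support z q (q + i) z-one (m≤m+n q i)
    ... | firableAt j d q≤j N≤d q+i≡j+d firable _ =
          inj₁ (j , q≤j , ≤-<-trans (subst (j + N ≤_) (sym q+i≡j+d) (+-monoʳ-≤ j N≤d)) (+-monoʳ-< q i<k) , firable)
    ... | groundedAt c e q≤c c<q+N q+i≡c+e bound =
          inj₂ (grounded-gap z w i c e i<k q≤c c<q+N q+i≡c+e bound w-zero agree)

    weight : BSeq → ℕ
    weight z = window (contribution z) q k

    gap-bounded : ∀ bound x y → energy K x + energy K y < bound → weight x < weight y → weight x + A p ≤ weight y
    gap-bounded (suc bound) x y small Wx<Wy with lastDifference (λ t → x (q + t)) (λ t → y (q + t)) k
    ... | inj₁ agree = ⊥-elim (<-irrefl (Σ<-cong k (λ i i<k → contribution-cong x y (q + i) (agree i i<k))) Wx<Wy)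
    ... | inj₂ (i , i<k , differ , agree) with x (q + i) in xi | y (q + i) in yi
    ...   | true  | true  = ⊥-elim (differ refl)
    ...   | false | false = ⊥-elim (differ refl)
    ...   | true  | false with top-difference x y i i<k xi yi agree
    ...     | inj₂ Wy+A≤Wx = ⊥-elim (<-irrefl refl (<-≤-trans Wx<Wy (≤-trans (m≤m+n _ _) Wy+A≤Wx)))
    ...     | inj₁ (j , q≤j , inside , firable) =
              subst (λ v → v + A p ≤ weight y) (fire-window j x firable q k q≤j inside)
                (gap-bounded bound (fire j x) y
                  (≤-trans (+-monoˡ-< (energy K y) (fire-energy j x firable K inside)) (≤-pred small))
                  (subst (_< weight y) (sym (fire-window j x firable q k q≤j inside)) Wx<Wy))
    gap-bounded (suc bound) x y small Wx<Wy | inj₂ (i , i<k , differ , agree) | false | true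
      with top-difference y x i i<k yi xi (λ t i<t t<k → sym (agree t i<t t<k))
    ...     | inj₂ Wx+A≤Wy = Wx+A≤Wy
    ...     | inj₁ (j , q≤j , inside , firable) =
              subst (λ v → weight x + A p ≤ v) (fire-window j y firable q k q≤j inside)
                (gap-bounded bound x (fire j y)
                  (≤-trans (+-monoʳ-< (energy K x) (fire-energy j y firable K inside)) (≤-pred small))
                  (subst (weight x <_) (sym (fire-window j y firable q k q≤j inside)) Wx<Wy))

  gap : ∀ p k x y → window (contribution x) (suc p) k < window (contribution y) (suc p) k →
        window (contribution x) (suc p) k + A p ≤ window (contribution y) (suc p) k
  gap p k x y = Gap.gap-bounded p k (suc (energy (suc p + k) x + energy (suc p + k) y)) x y (n<1+n _)

  Represents : ℕ → ℕ → BSeq → Set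
  Represents M n a = (∀ i → M ≤ i → a i ≡ false) × prefix a M ≡ n

  -- Otherwise the windows above p
  -- would differ by less than A_p, contradicting the gap lemma.
  non-crossing : ∀ {n M u v} → Represents M n u → Represents M n v → ∀ p → u p ≡ true → v p ≡ false →
                 ¬ (prefix u p < prefix v p × prefix v p < prefix u p + A p)
  non-crossing {M = M} {u} {v} (u-zeros , u-sum) (v-zeros , v-sum) p u-one v-zero (πu<πv , πv<πu+A) =
      <-irrefl refl (<-≤-trans πu<πv πv≤πu)
    where
      open ≤-Reasoning
      K = suc p + M
      su = window (contribution u) (suc p) M
      sv = window (contribution v) (suc p) M
      totals : prefix u p + A p + su ≡ prefix v p + sv
      totals = begin-equality
        prefix u p + A p + su                     ≡⟨ cong (λ w → prefix u p + w + su) (sym (contribution-one u p u-one)) ⟩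
        prefix u (suc p) + su                     ≡⟨ sym (prefix-split u (suc p) M) ⟩
        prefix u K                                ≡⟨ prefix-stable u M u-zeros K (m≤n+m M (suc p)) ⟩
        prefix u M                                ≡⟨ trans u-sum (sym v-sum) ⟩
        prefix v M                                ≡⟨ sym (prefix-stable v M v-zeros K (m≤n+m M (suc p))) ⟩
        prefix v K                                ≡⟨ prefix-split v (suc p) M ⟩
        prefix v p + contribution v p + sv        ≡⟨ cong (λ w → prefix v p + w + sv) (contribution-zero v p v-zero) ⟩
        prefix v p + 0 + sv                       ≡⟨ cong (_+ sv) (+-identityʳ _) ⟩
        prefix v p + sv                           ∎
      su<sv : su < sv
      su<sv with su <? sv
      ... | yes lt = lt
      ... | no su≮sv = ⊥-elim (<-irrefl (sym totals) (+-mono-<-≤ πv<πu+A (≮⇒≥ su≮sv)))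
      πv≤πu : prefix v p ≤ prefix u p
      πv≤πu = +-cancelʳ-≤ (su + A p) _ _ (begin
        prefix v p + (su + A p)   ≤⟨ +-monoʳ-≤ (prefix v p) (gap p M u v su<sv) ⟩
        prefix v p + sv           ≡⟨ sym totals ⟩
        prefix u p + A p + su     ≡⟨ +-assoc (prefix u p) _ _ ⟩
        prefix u p + (A p + su)   ≡⟨ cong (prefix u p +_) (+-comm (A p) su) ⟩
        prefix u p + (su + A p)   ∎)

  module Completeness {n M : ℕ} {a b : BSeq} (ra : Represents M n a) (rb : Represents M n b)
                      (a≼b : a ≼ b) (r : ℕ) (r<M : r < M) (agree : ∀ t → r < t → t < M → a t ≡ b t) where

    agree-after : prefix a (suc r) ≡ prefix b (suc r)
    agree-after = prefix-agree-retract a b (suc r) (M ∸ suc r)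
        (λ i i<l → agree (suc r + i) (s≤s (m≤m+n r i)) (subst (suc r + i <_) r+1+l≡M (+-monoʳ-< (suc r) i<l)))
        (subst (λ v → prefix a v ≡ prefix b v) (sym r+1+l≡M) (trans (proj₂ ra) (sym (proj₂ rb))))
      where
        r+1+l≡M : suc r + (M ∸ suc r) ≡ M
        r+1+l≡M = m+[n∸m]≡n r<M

    -- So b cannot have the 1 at r: then a ≼ b would make a fall behind.
    not-zero-one : a r ≡ false → b r ≡ true → prefix a (suc r) < prefix b (suc r)
    not-zero-one a-zero b-one = begin-strict
        prefix a r + contribution a r  ≡⟨ cong (prefix a r +_) (contribution-zero a r a-zero) ⟩
        prefix a r + 0                 ≡⟨ +-identityʳ _ ⟩
        prefix a r                     ≤⟨ a≼b r ⟩
        prefix b r                     <⟨ subst (_< prefix b r + A r) (+-identityʳ _) (+-monoʳ-< (prefix b r) (positive r)) ⟩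
        prefix b r + A r               ≡⟨ cong (prefix b r +_) (sym (contribution-one b r b-one)) ⟩
        prefix b r + contribution b r  ∎
      where open ≤-Reasoning

    -- Nor can the 1 of a at r be grounded: it would outweigh all of b below r.
    not-grounded : b r ≡ false → ∀ c e → c < N → r ≡ c + e →
                   A c + window A c e ≤ window (contribution a) c (suc e) → prefix b (suc r) < prefix a (suc r)
    not-grounded b-zero c e c<N r≡c+e bound = begin-strict
        prefix b r + contribution b r    ≡⟨ cong (prefix b r +_) (contribution-zero b r b-zero) ⟩
        prefix b r + 0                   ≡⟨ +-identityʳ _ ⟩
        prefix b r                       ≤⟨ Σ<-mono r (λ i _ → contribution≤A b i) ⟩
        Σ< r A                           ≡⟨ cong (λ v → Σ< v A) r≡c+e ⟩
        Σ< (c + e) A                     ≡⟨ Σ<-split c e A ⟩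
        Σ< c A + window A c e            <⟨ +-monoˡ-< (window A c e) (initial c c<N) ⟩
        A c + window A c e               ≤⟨ bound ⟩
        window (contribution a) c (suc e) ≤⟨ m≤n+m _ (prefix a c) ⟩
        prefix a c + window (contribution a) c (suc e) ≡⟨ sym (prefix-split a c (suc e)) ⟩
        prefix a (c + suc e)             ≡⟨ cong (prefix a) (trans (+-suc c e) (cong suc (sym r≡c+e))) ⟩
        prefix a (suc r)                 ∎
      where open ≤-Reasoning

    -- The weight bound of a firable support at j, transported to b through
    -- agree-after, bounds π_b from below along the support.
    support-bounds-b : b r ≡ false → ∀ j d → r ≡ j + d → window A j d ≤ window (contribution a) j (suc d) →
                       ∀ d′ → d′ ≤ d → prefix a j + window A j d′ ≤ prefix b (j + d′)
    support-bounds-b b-zero j d r≡j+d bound d′ d′≤d = +-cancelʳ-≤ (window A (j + d′) h) _ _ (begin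
        prefix a j + window A j d′ + window A (j + d′) h    ≡⟨ +-assoc (prefix a j) _ _ ⟩
        prefix a j + (window A j d′ + window A (j + d′) h)  ≡⟨ cong (prefix a j +_) (sym (window-split A j d′ h)) ⟩
        prefix a j + window A j (d′ + h)                    ≡⟨ cong (λ v → prefix a j + window A j v) d′+h≡d ⟩
        prefix a j + window A j d                           ≤⟨ +-monoʳ-≤ (prefix a j) bound ⟩
        prefix a j + window (contribution a) j (suc d)      ≡⟨ sym (prefix-split a j (suc d)) ⟩
        prefix a (j + suc d)                                ≡⟨ cong (prefix a) (trans (+-suc j d) (cong suc (sym r≡j+d))) ⟩
        prefix a (suc r)                                    ≡⟨ agree-after ⟩
        prefix b (suc r)                                    ≡⟨ cong (prefix b) (sym (trans (+-suc (j + d′) h) (cong suc j+d′+h≡r))) ⟩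
        prefix b (j + d′ + suc h)                           ≡⟨ prefix-split b (j + d′) (suc h) ⟩
        prefix b (j + d′) + window (contribution b) (j + d′) (suc h)
                                                            ≤⟨ +-monoʳ-≤ (prefix b (j + d′)) (zero-capped b (j + d′) h (trans (cong b j+d′+h≡r) b-zero)) ⟩
        prefix b (j + d′) + window A (j + d′) h             ∎)
      where
        open ≤-Reasoning
        h = d ∸ d′
        d′+h≡d : d′ + h ≡ d
        d′+h≡d = m+[n∸m]≡n d′≤d
        j+d′+h≡r : j + d′ + h ≡ r
        j+d′+h≡r = trans (+-assoc j d′ h) (trans (cong (j +_) d′+h≡d) (sym r≡j+d))

    -- Firing the block supporting the 1 of a at r keeps a below b: outside
    -- the block nothing changes, inside it support-bounds-b applies.
    fire-dominated : b r ≡ false → ∀ j d → N ≤ d → r ≡ j + d → (firable : Firable a j) →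
                     window A j d ≤ window (contribution a) j (suc d) → fire j a ≼ b
    fire-dominated b-zero j d N≤d r≡j+d firable bound p with windowCases j p
    ... | inj₁ p≤j                     = subst (_≤ prefix b p) (below p p≤j) (a≼b p)
      where open FireFacts j a firable
    ... | inj₂ (inj₂ lt)               = subst (_≤ prefix b p) (above p lt) (a≼b p)
      where open FireFacts j a firable
    ... | inj₂ (inj₁ (d′ , d′≤N , refl)) = subst (_≤ prefix b (j + d′)) (sym (inside-b d′ d′≤N))
                                             (support-bounds-b b-zero j d r≡j+d bound d′ (≤-trans d′≤N N≤d))
      where open FireFacts j a firable

    descend : ¬ (a r ≡ b r) → Σ ℕ λ j → Firable a j × j + N < M × fire j a ≼ b
    descend differ with a r in ar | b r in br
    ... | true  | true  = ⊥-elim (differ refl)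
    ... | false | false = ⊥-elim (differ refl)
    ... | false | true  = ⊥-elim (<-irrefl agree-after (not-zero-one ar br))
    ... | true  | false with support a 0 r ar z≤n
    ...   | groundedAt c e _ c<N r≡c+e bound = ⊥-elim (<-irrefl (sym agree-after) (not-grounded br c e c<N r≡c+e bound))
    ...   | firableAt j d _ N≤d r≡j+d firable bound =
            j , firable , ≤-<-trans (subst (j + N ≤_) (sym r≡j+d) (+-monoʳ-≤ j N≤d)) r<M ,
            fire-dominated br j d N≤d r≡j+d firable bound

  path-from-dominated : ∀ {n M} bound a b → energy M a < bound → Represents M n a → Represents M n b →
                        a ≼ b → Path N A n a b
  path-from-dominated {n} {M} (suc bound) a b small ra rb a≼b with lastDifference a b M
  ... | inj₁ agree = done same
    where same : a ≈ₛ b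
          same i with M ≤? i
          ... | yes M≤i = trans (proj₁ ra i M≤i) (sym (proj₁ rb i M≤i))
          ... | no M≰i  = agree i (≰⇒> M≰i)
  ... | inj₂ (r , r<M , differ , agree) with Completeness.descend ra rb a≼b r r<M agree differ
  ...   | j , firable , j+N<M , fired≼b =
          step (inS ra , inS rb′ , fire-move j a firable)
               (path-from-dominated bound (fire j a) b (≤-trans (fire-energy j a firable M j+N<M) (≤-pred small)) rb′ rb fired≼b)
    where
      open FireFacts j a firable
      rb′ : Represents M n (fire j a)
      rb′ = (λ i M≤i → trans (sym (fire-outside j a i (inj₂ (<-≤-trans j+N<M M≤i)))) (proj₁ ra i M≤i)) ,
            trans (sym (above M j+N<M)) (proj₂ ra)
      inS : ∀ {z} → Represents M n z → InS A n z
      inS (zeros , sum) = M , zeros , sum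

  dominated-path : ∀ {n M a b} → Represents M n a → Represents M n b → a ≼ b → Path N A n a b
  dominated-path {M = M} {a} {b} ra rb = path-from-dominated (suc (energy M a)) a b (n<1+n _) ra rb

  Profile : (ℕ → ℕ) → Set
  Profile g = ∀ p → g (suc p) ≡ g p ⊎ g (suc p) ≡ g p + A p

  fromProfile : (ℕ → ℕ) → BSeq
  fromProfile g i with g (suc i) ≟ g i
  ... | yes _ = false
  ... | no _  = true

  fromProfile-zero : ∀ g i → g (suc i) ≡ g i → fromProfile g i ≡ false
  fromProfile-zero g i flat with g (suc i) ≟ g i
  ... | yes _     = refl
  ... | no unflat = ⊥-elim (unflat flat)

  fromProfile-one : ∀ g i → ¬ (g (suc i) ≡ g i) → fromProfile g i ≡ true
  fromProfile-one g i unflat with g (suc i) ≟ g i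
  ... | yes flat = ⊥-elim (unflat flat)
  ... | no _     = refl

  +A≢ : ∀ m i → ¬ (m + A i ≡ m)
  +A≢ m i with A i | positive i
  ... | suc _ | _ = m+1+n≢m m

  prefix-fromProfile : ∀ g → g 0 ≡ 0 → Profile g → ∀ p → prefix (fromProfile g) p ≡ g p
  prefix-fromProfile g g0 profile zero = sym g0
  prefix-fromProfile g g0 profile (suc p) with profile p
  ... | inj₁ flat = trans (cong₂ _+_ (prefix-fromProfile g g0 profile p) (contribution-zero (fromProfile g) p (fromProfile-zero g p flat)))
                          (trans (+-identityʳ _) (sym flat))
  ... | inj₂ grow = trans (cong₂ _+_ (prefix-fromProfile g g0 profile p)
                            (contribution-one (fromProfile g) p (fromProfile-one g p (λ flat → +A≢ (g p) p (trans (sym grow) flat)))))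
                          (sym grow)

  fromProfile-copies : ∀ g x i → g (suc i) ≡ prefix x (suc i) → g i ≡ prefix x i → fromProfile g i ≡ x i
  fromProfile-copies g x i at-suc at-i with x i in xi
  ... | true  = fromProfile-one g i (λ flat → +A≢ (prefix x i) i (trans (sym at-suc) (trans flat at-i)))
  ... | false = fromProfile-zero g i (trans at-suc (trans (+-identityʳ _) (sym at-i)))

  -- Laws of an operation ∘ on ℕ (instantiated by ⊓ and ⊔) that make
  -- p ↦ π_u(p) ∘ π_v(p) the profile of an element of S_n.
  record Selection (_∘_ : ℕ → ℕ → ℕ) : Set where
    field
      comm     : ∀ a b → a ∘ b ≡ b ∘ a
      idem     : ∀ a → a ∘ a ≡ a
      shift    : ∀ c a b → (a ∘ b) + c ≡ (a + c) ∘ (b + c)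
      one-step : ∀ a b c → ¬ (a < b × b < a + c) → ((a + c) ∘ b ≡ a ∘ b) ⊎ ((a + c) ∘ b ≡ a ∘ b + c)

  ⊓-selection : Selection _⊓_
  ⊓-selection = record { comm = ⊓-comm ; idem = ⊓-idem ; shift = +-distribʳ-⊓ ; one-step = ⊓-step }

  ⊔-selection : Selection _⊔_
  ⊔-selection = record { comm = ⊔-comm ; idem = ⊔-idem ; shift = +-distribʳ-⊔ ; one-step = ⊔-step }

  combine : (ℕ → ℕ → ℕ) → BSeq → BSeq → BSeq
  combine _∘_ u v = fromProfile (λ p → prefix u p ∘ prefix v p)

  -- The join takes the smaller, the meet the larger prefix sums.
  join meet : BSeq → BSeq → BSeq
  join = combine _⊓_
  meet = combine _⊔_

  prefix-after-last : ∀ {M n x r} → Represents M n x → Last x r → ∀ i → suc r ≤ i → prefix x i ≡ n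
  prefix-after-last {M} {x = x} {r} (zeros , sum) (_ , above-last) i r<i =
    trans (prefix-stable x (suc r) above-last i r<i)
      (trans (sym (prefix-stable x (suc r) above-last (M + suc r) (m≤n+m _ M)))
             (trans (prefix-stable x M zeros (M + suc r) (m≤m+n M _)) sum))

  module Combination {n M : ℕ} {u v : BSeq} (ru : Represents M n u) (rv : Represents M n v)
                     {_∘_ : ℕ → ℕ → ℕ} (law : Selection _∘_) where
    open Selection law

    g : ℕ → ℕ
    g p = prefix u p ∘ prefix v p

    -- Non-crossing is exactly what makes g grow by 0 or A_p.
    profile : Profile g
    profile p with u p in up | v p in vp
    ... | true  | true  = inj₂ (sym (shift (A p) (prefix u p) (prefix v p)))
    ... | false | false = inj₁ (cong₂ _∘_ (+-identityʳ _) (+-identityʳ _))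
    ... | true  | false = subst (λ w → ((prefix u p + A p) ∘ w ≡ g p) ⊎ ((prefix u p + A p) ∘ w ≡ g p + A p))
                            (sym (+-identityʳ _)) (one-step _ _ (A p) (non-crossing ru rv p up vp))
    ... | false | true  = subst (λ w → (w ≡ g p) ⊎ (w ≡ g p + A p))
                            (trans (comm _ _) (cong (_∘ (prefix v p + A p)) (sym (+-identityʳ _))))
                            (subst (λ w → ((prefix v p + A p) ∘ prefix u p ≡ w) ⊎ ((prefix v p + A p) ∘ prefix u p ≡ w + A p))
                              (comm _ _) (one-step _ _ (A p) (non-crossing rv ru p vp up)))

    prefix-combine : ∀ p → prefix (combine _∘_ u v) p ≡ g p
    prefix-combine = prefix-fromProfile g (idem 0) profile

    represents : Represents M n (combine _∘_ u v)
    represents = (λ i M≤i → fromProfile-zero g i (cong₂ _∘_ (settled u (proj₁ ru) i M≤i) (settled v (proj₁ rv) i M≤i))) ,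
                 trans (prefix-combine M) (trans (cong₂ _∘_ (proj₂ ru) (proj₂ rv)) (idem n))
      where
        settled : ∀ z → (∀ i → M ≤ i → z i ≡ false) → ∀ i → M ≤ i → prefix z (suc i) ≡ prefix z i
        settled z zeros i M≤i = trans (prefix-stable z M zeros (suc i) (≤-trans M≤i (n≤1+n i)))
                                      (sym (prefix-stable z M zeros i M≤i))

    -- Sequences with the same last 1 have equal prefix sums from there on,
    -- so the combination copies both of them there.
    preserves-last : ∀ r → Last u r → Last v r → Last (combine _∘_ u v) r
    preserves-last r lu@(ur , u-above) lv@(vr , v-above) =
        trans (copies r ≤-refl) ur , λ i r<i → trans (copies i (<⇒≤ r<i)) (u-above i r<i)
      where
        equal-from : ∀ i → r ≤ i → prefix u i ≡ prefix v i
        equal-from i r≤i with i ≟ r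
        ... | no i≢r = trans (prefix-after-last ru lu i r<i) (sym (prefix-after-last rv lv i r<i))
          where r<i = ≤∧≢⇒< r≤i (λ e → i≢r (sym e))
        ... | yes refl = +-cancelʳ-≡ _ _ _
              (trans (cong (prefix u i +_) (sym (contribution-one u i ur)))
                (trans (trans (prefix-after-last ru lu (suc i) ≤-refl) (sym (prefix-after-last rv lv (suc i) ≤-refl)))
                       (cong (prefix v i +_) (contribution-one v i vr))))
        g≡u : ∀ i → r ≤ i → g i ≡ prefix u i
        g≡u i r≤i = trans (cong (prefix u i ∘_) (sym (equal-from i r≤i))) (idem _)
        copies : ∀ i → r ≤ i → combine _∘_ u v i ≡ u i
        copies i r≤i = fromProfile-copies g u i (g≡u (suc i) (≤-trans r≤i (n≤1+n i))) (g≡u i r≤i)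

  common-bound : ∀ {n x y} → InS A n x → InS A n y → Σ ℕ λ M → Represents M n x × Represents M n y
  common-bound {x = x} {y} (Mx , x-zeros , x-sum) (My , y-zeros , y-sum) =
    Mx + My ,
    ((λ i le → x-zeros i (≤-trans (m≤m+n Mx My) le)) , trans (prefix-stable x Mx x-zeros _ (m≤m+n Mx My)) x-sum) ,
    ((λ i le → y-zeros i (≤-trans (m≤n+m My Mx) le)) , trans (prefix-stable y My y-zeros _ (m≤n+m My Mx)) y-sum)

  Closed : (BSeq → Set) → Set
  Closed X = ∀ {_∘_} → Selection _∘_ → ∀ {x y} → X x → X y → X (combine _∘_ x y)

  SetP-closed : ∀ n → Closed (SetP A n)
  SetP-closed n law px py with common-bound px py
  ... | M , rx , ry = M , Combination.represents rx ry law

  SetU-closed : ∀ n k → Closed (SetU A n k)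
  SetU-closed n k law (px , lx) (py , ly) with common-bound px py
  ... | M , rx , ry = (M , Combination.represents rx ry law) , Combination.preserves-last rx ry law k lx ly

  SetD-closed : ∀ n k → Closed (SetD A n k)
  SetD-closed n k law {y = y} (px , j , 1+j≡k , lx) (py , j′ , 1+j′≡k , ly) with common-bound px py
  ... | M , rx , ry = (M , Combination.represents rx ry law) , j , 1+j≡k ,
                      Combination.preserves-last rx ry law j lx (subst (Last y) (suc-injective (trans 1+j′≡k (sym 1+j≡k))) ly)

  -- By the order characterisation x ≤ y iff π_y ≤ π_x
  -- pointwise, so join and meet are pointwise min and max of prefix sums,
  -- and the modular law is inherited from ℕ.
  module Sublattice (n : ℕ) (X : BSeq → Set) (inS : ∀ {a} → X a → InS A n a) (closed : Closed X) where
    _≤X_ : Elt X → Elt X → Set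
    _≤X_ = Le N A n X

    _≈X_ : Elt X → Elt X → Set
    _≈X_ = _≈ᴱ_ {X = X}

    _∨_ _∧_ : Elt X → Elt X → Elt X
    (x , px) ∨ (y , py) = join x y , closed ⊓-selection px py
    (x , px) ∧ (y , py) = meet x y , closed ⊔-selection px py

    π : Elt X → ℕ → ℕ
    π (x , _) = prefix x

    order-sound : ∀ u v → u ≤X v → ∀ p → π v p ≤ π u p
    order-sound u v = path-dominated

    order-complete : ∀ u v → (∀ p → π v p ≤ π u p) → u ≤X v
    order-complete (x , px) (y , py) y≼x with common-bound (inS py) (inS px)
    ... | M , ry , rx = dominated-path ry rx y≼x

    π-join : ∀ u v p → π (u ∨ v) p ≡ π u p ⊓ π v p
    π-join (x , px) (y , py) with common-bound (inS px) (inS py)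
    ... | M , rx , ry = Combination.prefix-combine rx ry ⊓-selection

    π-meet : ∀ u v p → π (u ∧ v) p ≡ π u p ⊔ π v p
    π-meet (x , px) (y , py) with common-bound (inS px) (inS py)
    ... | M , rx , ry = Combination.prefix-combine rx ry ⊔-selection

    partialOrder : IsPartialOrder _≈X_ _≤X_
    partialOrder = record
      { isPreorder = record
        { isEquivalence = record { refl = λ i → refl ; sym = λ e i → sym (e i) ; trans = λ e f i → trans (e i) (f i) }
        ; reflexive     = λ e → done (λ i → sym (e i))
        ; trans         = λ {u} {v} {w} u≤v v≤w → order-complete u w (λ p → ≤-trans (order-sound v w v≤w p) (order-sound u v u≤v p))
        }
      ; antisym = λ {u} {v} u≤v v≤u → prefix-injective (proj₁ u) (proj₁ v)
                    (λ p → ≤-antisym (order-sound v u v≤u p) (order-sound u v u≤v p))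
      }

    lattice : IsLattice _≈X_ _≤X_ _∨_ _∧_
    lattice = record
      { isPartialOrder = partialOrder
      ; supremum = λ u v →
          order-complete u (u ∨ v) (λ p → subst (_≤ π u p) (sym (π-join u v p)) (m⊓n≤m _ _)) ,
          order-complete v (u ∨ v) (λ p → subst (_≤ π v p) (sym (π-join u v p)) (m⊓n≤n _ _)) ,
          λ w u≤w v≤w → order-complete (u ∨ v) w
            (λ p → subst (π w p ≤_) (sym (π-join u v p)) (⊓-glb (order-sound u w u≤w p) (order-sound v w v≤w p)))
      ; infimum = λ u v →
          order-complete (u ∧ v) u (λ p → subst (π u p ≤_) (sym (π-meet u v p)) (m≤m⊔n _ _)) ,
          order-complete (u ∧ v) v (λ p → subst (π v p ≤_) (sym (π-meet u v p)) (m≤n⊔m _ _)) ,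
          λ w w≤u w≤v → order-complete w (u ∧ v)
            (λ p → subst (_≤ π w p) (sym (π-meet u v p)) (⊔-lub (order-sound w u w≤u p) (order-sound w v w≤v p)))
      }

    modular : ∀ x y z → x ≤X z → ((x ∨ y) ∧ z) ≈X (x ∨ (y ∧ z))
    modular x y z x≤z = prefix-injective _ _ λ p → begin
        π ((x ∨ y) ∧ z) p          ≡⟨ π-meet (x ∨ y) z p ⟩
        π (x ∨ y) p ⊔ π z p        ≡⟨ cong (_⊔ π z p) (π-join x y p) ⟩
        (π x p ⊓ π y p) ⊔ π z p    ≡⟨ ⊓-⊔-modular (π x p) (π y p) (π z p) (order-sound x z x≤z p) ⟩
        π x p ⊓ (π y p ⊔ π z p)    ≡⟨ cong (π x p ⊓_) (sym (π-meet y z p)) ⟩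
        π x p ⊓ π (y ∧ z) p        ≡⟨ sym (π-join x (y ∧ z) p) ⟩
        π (x ∨ (y ∧ z)) p          ∎
      where open ≡-Reasoning

    modularLattice : IsModularLattice _≈X_ _≤X_
    modularLattice = _∨_ , _∧_ , lattice , modular

theorem5p1 : (N : ℕ) → 2 ≤ N → (A : ℕ → ℕ) → QuasiFib N A →
    (n : ℕ) → 1 ≤ n →
      ModularIfNonempty N A n (SetP A n) ×
      (∀ k → A k ≤ n → n < A (suc k) →
        ModularIfNonempty N A n (SetU A n k) ×
        ModularIfNonempty N A n (SetD A n k))
theorem5p1 N _ A qf n _ = modularP , λ k _ _ → modularU k , modularD k
  where
    open QuasiFibonacci N A qf
    modularP : ModularIfNonempty N A n (SetP A n)
    modularP _ = Sublattice.modularLattice n (SetP A n) (λ p → p) (SetP-closed n)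
    modularU : ∀ k → ModularIfNonempty N A n (SetU A n k)
    modularU k _ = Sublattice.modularLattice n (SetU A n k) proj₁ (SetU-closed n k)
    modularD : ∀ k → ModularIfNonempty N A n (SetD A n k)
    modularD k _ = Sublattice.modularLattice n (SetD A n k) proj₁ (SetD-closed n k)
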